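{- The axiomatization consisting of A1-4, WE and TE is sound and ground-complete for BCCS($A$) modulo $\simeq_{\rm WT}$. If $|A|>1$, this axiomatization is also $\omega$-complete.
   Context: $A$ is a nonempty countable set of actions, $\tau\notin A$, $A_\tau=A\cup\{\tau\}$. BCCS($A$) terms: $t::=0\mid x\mid\alpha t\mid t+t$ ($x$ a variable, $\alpha\in A_\tau$). Transitions: $\alpha t\xrightarrow{\alpha}t$; if $t\xrightarrow{\alpha}t'$ then $t+u\xrightarrow{\alpha}t'$ and $u+t\xrightarrow{\alpha}t'$. $\Rightarrow$ is the reflexive-transitive closure of $\xrightarrow{\tau}$. $a_1\cdots a_k\in A^*$ is a weak trace of closed $s$ if $s\Rightarrow\xrightarrow{a_1}\Rightarrow\cdots\xrightarrow{a_k}\Rightarrow s'$ for some $s'$; $\mathcal{WT}(s)$ the set. $s_1\simeq_{\rm WT}s_2$ iff $\mathcal{WT}(s_1)=\mathcal{WT}(s_2)$; on open terms via all closed substitutions. Equational logic (reflexivity, symmetry, transitivity, substitution instances, closure under contexts); sound, ground-complete, $\omega$-complete (if all closed instances are derivable then the equation is). Axioms ($a$ ranges over $A$): A1: $x+y\approx y+x$; A2: $(x+y)+z\approx x+(y+z)$; A3: $x+x\approx x$; A4: $x+0\approx x$; WE: $x\approx\tau x$; TE: $ax+ay\approx a(x+y)$. -}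

module Defs where

open import Data.Nat using (ℕ)
open import Data.Empty using (⊥; ⊥-elim)
open import Data.List using (List; []; _∷_)
open import Data.Product using (Σ; _×_; _,_; ∃)
open import Function.Bundles using (_↣_; _⇔_)
open import Relation.Nullary using (¬_)
open import Relation.Binary.PropositionalEquality using (_≡_)

data Act (A : Set) : Set where
  τ   : Act A
  act : A → Act A

infixr 7 _·_
infixl 6 _⊕_
data Term (A : Set) (V : Set) : Set where
  𝟘   : Term A V
  var : V → Term A V
  _·_ : Act A → Term A V → Term A V
  _⊕_ : Term A V → Term A V → Term A V

OpenTerm : Set → Set
OpenTerm A = Term A ℕ

ClosedTerm : Set → Set
ClosedTerm A = Term A ⊥

subst : {A V W : Set} → (V → Term A W) → Term A V → Term A W
subst σ 𝟘       = 𝟘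
subst σ (var x) = σ x
subst σ (α · t) = α · subst σ t
subst σ (t ⊕ u) = subst σ t ⊕ subst σ u

embed : {A : Set} → ClosedTerm A → OpenTerm A
embed = subst (λ ())

closeWith : {A : Set} → (ℕ → ClosedTerm A) → OpenTerm A → ClosedTerm A
closeWith σ = subst σ

data _—[_]→_ {A : Set} : ClosedTerm A → Act A → ClosedTerm A → Set where
  pre  : ∀ {α t} → (α · t) —[ α ]→ t
  sumL : ∀ {t t' u α} → t —[ α ]→ t' → (t ⊕ u) —[ α ]→ t'
  sumR : ∀ {t t' u α} → t —[ α ]→ t' → (u ⊕ t) —[ α ]→ t'

data _⇒_ {A : Set} : ClosedTerm A → ClosedTerm A → Set where
  ⇒-refl : ∀ {s} → s ⇒ s
  ⇒-step : ∀ {s s' s''} → s —[ τ ]→ s' → s' ⇒ s'' → s ⇒ s''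

data WeakTrace {A : Set} : ClosedTerm A → List A → Set where
  wt-nil  : ∀ {s} → WeakTrace s []
  wt-cons : ∀ {s s₁ s₂ a w} → s ⇒ s₁ → s₁ —[ act a ]→ s₂ → WeakTrace s₂ w
          → WeakTrace s (a ∷ w)

_≃WT_ : {A : Set} → ClosedTerm A → ClosedTerm A → Set
s₁ ≃WT s₂ = ∀ w → WeakTrace s₁ w ⇔ WeakTrace s₂ w

_≃WTᵒ_ : {A : Set} → OpenTerm A → OpenTerm A → Set
t ≃WTᵒ u = ∀ σ → closeWith σ t ≃WT closeWith σ u

private
  x y z : {A : Set} → OpenTerm A
  x = var 0
  y = var 1
  z = var 2

data Axiom {A : Set} : OpenTerm A → OpenTerm A → Set where
  A1 : Axiom (x ⊕ y) (y ⊕ x)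
  A2 : Axiom ((x ⊕ y) ⊕ z) (x ⊕ (y ⊕ z))
  A3 : Axiom (x ⊕ x) x
  A4 : Axiom (x ⊕ 𝟘) x
  WE : Axiom x (τ · x)
  TE : (a : A) → Axiom ((act a · x) ⊕ (act a · y)) (act a · (x ⊕ y))

data _⊢_≈_ {A : Set} (E : OpenTerm A → OpenTerm A → Set) : OpenTerm A → OpenTerm A → Set where
  ax    : ∀ {t u} → E t u → E ⊢ t ≈ u
  refl  : ∀ {t} → E ⊢ t ≈ t
  sym   : ∀ {t u} → E ⊢ t ≈ u → E ⊢ u ≈ t
  trans : ∀ {t u v} → E ⊢ t ≈ u → E ⊢ u ≈ v → E ⊢ t ≈ v
  inst  : ∀ {t u} (σ : ℕ → OpenTerm A) → E ⊢ t ≈ u → E ⊢ subst σ t ≈ subst σ u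
  pre   : ∀ {t u} (α : Act A) → E ⊢ t ≈ u → E ⊢ (α · t) ≈ (α · u)
  plus  : ∀ {t t' u u'} → E ⊢ t ≈ t' → E ⊢ u ≈ u' → E ⊢ (t ⊕ u) ≈ (t' ⊕ u')

Sound : {A : Set} → (OpenTerm A → OpenTerm A → Set) → Set
Sound {A} E = (t u : OpenTerm A) → E ⊢ t ≈ u → t ≃WTᵒ u

GroundComplete : {A : Set} → (OpenTerm A → OpenTerm A → Set) → Set
GroundComplete {A} E = (p q : ClosedTerm A) → p ≃WT q → E ⊢ embed p ≈ embed q

OmegaComplete : {A : Set} → (OpenTerm A → OpenTerm A → Set) → Set
OmegaComplete {A} E = (t u : OpenTerm A)
  → ((σ : ℕ → ClosedTerm A) → E ⊢ embed (closeWith σ t) ≈ embed (closeWith σ u))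
  → E ⊢ t ≈ u

AtLeastTwo : Set → Set
AtLeastTwo A = Σ A λ a → Σ A λ b → ¬ (a ≡ b)

Countable : Set → Set
Countable A = A ↣ ℕ

-- Soundness: weak-trace inclusion ⊑ is a preorder on closed terms for which
-- ⊕ is a least upper bound, 𝟘 is least, prefixing is monotone and τ is
-- invisible; hence every closed instance of every axiom, and then of every
-- derivable equation, relates weak-trace-equivalent terms.
--
-- Completeness: we give open terms a symbolic semantics of "runs": a run of
-- t over w is a weak trace w of t ending either anywhere (a plain trace) or
-- in a state with a variable x in head position.  Run inclusion t ≼ u makes
-- u ⊕ t ≈ u derivable ("saturation", by induction on t using the
-- a-derivative der a u, which collects the a-successors of u); so mutual run
-- inclusion gives t ≈ u.  Finally run inclusion is read off from closed
-- instances: plain traces from the instance sending every variable to 𝟘, and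
-- (when A has two actions a ≠ b) x-runs over w from the instance sending x to
-- the "probe" b·aᴺ, N exceeding the depth of u, whose trace w b aᴺ can only
-- be produced by u through an x-run over w.  Ground-completeness uses the
-- fact that closed terms have no variable runs.

module Submission where

open import Defs
open import Data.Nat as ℕ using (ℕ; zero; suc; _≤_; _<_; _⊔_; z≤n; s≤s)
import Data.Nat.Properties as ℕ
open import Data.Empty using (⊥-elim)
open import Data.Unit using (⊤; tt)
open import Data.List using (List; []; _∷_; _++_; length; replicate)
open import Data.List.Properties using (∷-injectiveˡ; ∷-injectiveʳ; ++-identityʳ; length-replicate)
open import Data.List.Membership.Propositional using (_∈_; _∉_)
open import Data.List.Membership.Propositional.Properties using (∈-++⁺ʳ)
open import Data.List.Relation.Unary.Any using (here; there)
open import Data.Product using (∃-syntax; _×_; _,_)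
open import Data.Sum using (_⊎_; inj₁; inj₂)
open import Function using (_∘_)
open import Function.Bundles using (mk⇔; Equivalence)
import Function.Properties.Equivalence as ⇔
open import Relation.Nullary using (¬_; yes; no)
open import Relation.Nullary.Decidable using (via-injection)
open import Relation.Binary.Bundles using (Setoid)
open import Relation.Binary.Definitions using (DecidableEquality)
import Relation.Binary.Reasoning.Setoid as SetoidReasoning
open import Relation.Binary.PropositionalEquality as ≡ using (_≡_; cong; cong₂)

countable-decEq : {A : Set} → Countable A → DecidableEquality A
countable-decEq c = via-injection c ℕ._≟_

marker-split : {A : Set} {b : A} (u v : List A) {ys zs : List A}
  → b ∉ ys → b ∉ zs → u ++ b ∷ ys ≡ v ++ b ∷ zs → u ≡ v
marker-split []      []      b∉ys b∉zs eq = ≡.refl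
marker-split []      (c ∷ v) b∉ys b∉zs eq =
  ⊥-elim (b∉ys (≡.subst (_ ∈_) (≡.sym (∷-injectiveʳ eq)) (∈-++⁺ʳ v (here ≡.refl))))
marker-split (c ∷ u) []      b∉ys b∉zs eq =
  ⊥-elim (b∉zs (≡.subst (_ ∈_) (∷-injectiveʳ eq) (∈-++⁺ʳ u (here ≡.refl))))
marker-split (c ∷ u) (d ∷ v) b∉ys b∉zs eq =
  cong₂ _∷_ (∷-injectiveˡ eq) (marker-split u v b∉ys b∉zs (∷-injectiveʳ eq))

subst-subst : {A U V W : Set} (σ : V → Term A W) (ρ : U → Term A V) (t : Term A U)
  → subst σ (subst ρ t) ≡ subst (subst σ ∘ ρ) t
subst-subst σ ρ 𝟘       = ≡.refl
subst-subst σ ρ (var x) = ≡.refl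
subst-subst σ ρ (α · t) = cong (α ·_) (subst-subst σ ρ t)
subst-subst σ ρ (t ⊕ u) = cong₂ _⊕_ (subst-subst σ ρ t) (subst-subst σ ρ u)

close-embed : {A : Set} (σ : ℕ → ClosedTerm A) (p : ClosedTerm A) → closeWith σ (embed p) ≡ p
close-embed σ 𝟘       = ≡.refl
close-embed σ (var ())
close-embed σ (α · p) = cong (α ·_) (close-embed σ p)
close-embed σ (p ⊕ q) = cong₂ _⊕_ (close-embed σ p) (close-embed σ q)

depth : {A V : Set} → Term A V → ℕ
depth 𝟘       = 0
depth (var x) = 0
depth (α · t) = suc (depth t)
depth (t ⊕ u) = depth t ⊔ depth u

-- The two kinds of observation at the end of a symbolic run: none (a plain
-- trace), or the variable x in head position.
data Obs : Set where
  trace  : Obs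
  var-at : ℕ → Obs

module _ {A : Set} where

  private variable
    s s' t t' u r : ClosedTerm A
    α : Act A
    a : A
    w : List A

  ⇒-trans : s ⇒ t → t ⇒ r → s ⇒ r
  ⇒-trans ⇒-refl         q = q
  ⇒-trans (⇒-step st p) q = ⇒-step st (⇒-trans p q)

  infix 4 _⊑_
  _⊑_ : ClosedTerm A → ClosedTerm A → Set
  s ⊑ t = ∀ {w} → WeakTrace s w → WeakTrace t w

  ⊑-antisym : s ⊑ t → t ⊑ s → s ≃WT t
  ⊑-antisym f g w = mk⇔ f g

  ≃⇒⊑ : s ≃WT t → s ⊑ t
  ≃⇒⊑ e {w} = Equivalence.to (e w)

  ≃-sym : s ≃WT t → t ≃WT s
  ≃-sym e w = ⇔.sym (e w)

  ⊕-ubˡ : s ⊑ s ⊕ t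
  ⊕-ubˡ wt-nil                          = wt-nil
  ⊕-ubˡ (wt-cons ⇒-refl st r)          = wt-cons ⇒-refl (sumL st) r
  ⊕-ubˡ (wt-cons (⇒-step st p) st' r) = wt-cons (⇒-step (sumL st) p) st' r

  ⊕-ubʳ : t ⊑ s ⊕ t
  ⊕-ubʳ wt-nil                          = wt-nil
  ⊕-ubʳ (wt-cons ⇒-refl st r)          = wt-cons ⇒-refl (sumR st) r
  ⊕-ubʳ (wt-cons (⇒-step st p) st' r) = wt-cons (⇒-step (sumR st) p) st' r

  ⊕-split : WeakTrace (s ⊕ t) w → WeakTrace s w ⊎ WeakTrace t w
  ⊕-split wt-nil                                 = inj₁ wt-nil
  ⊕-split (wt-cons ⇒-refl (sumL st) w)          = inj₁ (wt-cons ⇒-refl st w)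
  ⊕-split (wt-cons ⇒-refl (sumR st) w)          = inj₂ (wt-cons ⇒-refl st w)
  ⊕-split (wt-cons (⇒-step (sumL st) p) st' w) = inj₁ (wt-cons (⇒-step st p) st' w)
  ⊕-split (wt-cons (⇒-step (sumR st) p) st' w) = inj₂ (wt-cons (⇒-step st p) st' w)

  ⊕-lub : s ⊑ r → t ⊑ r → s ⊕ t ⊑ r
  ⊕-lub f g w with ⊕-split w
  ... | inj₁ ws = f ws
  ... | inj₂ wt = g wt

  𝟘-trace : WeakTrace {A} 𝟘 w → w ≡ []
  𝟘-trace wt-nil                   = ≡.refl
  𝟘-trace (wt-cons ⇒-refl () _)
  𝟘-trace (wt-cons (⇒-step () _) _ _)

  𝟘-least : 𝟘 ⊑ s
  𝟘-least r with 𝟘-trace r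
  ... | ≡.refl = wt-nil

  τ-intro : s ⊑ τ · s
  τ-intro wt-nil           = wt-nil
  τ-intro (wt-cons p st r) = wt-cons (⇒-step pre p) st r

  τ-elim : τ · s ⊑ s
  τ-elim wt-nil                         = wt-nil
  τ-elim (wt-cons (⇒-step pre p) st r) = wt-cons p st r

  ·-mono : s ⊑ t → α · s ⊑ α · t
  ·-mono {α = τ}     h r                                = τ-intro (h (τ-elim r))
  ·-mono {α = act a} h wt-nil                           = wt-nil
  ·-mono {α = act a} h (wt-cons ⇒-refl pre r)          = wt-cons ⇒-refl pre (h r)
  ·-mono {α = act a} h (wt-cons (⇒-step () _) _ _)

  -- The nontrivial half of TE: after a the choice between s and t is still open.
  act-⊕-split : act a · (s ⊕ t) ⊑ act a · s ⊕ act a · t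
  act-⊕-split wt-nil = wt-nil
  act-⊕-split (wt-cons ⇒-refl pre r) with ⊕-split r
  ... | inj₁ rs = ⊕-ubˡ (wt-cons ⇒-refl pre rs)
  ... | inj₂ rt = ⊕-ubʳ (wt-cons ⇒-refl pre rt)
  act-⊕-split (wt-cons (⇒-step () _) _ _)

  ·-cong : s ≃WT t → (α · s) ≃WT (α · t)
  ·-cong e = ⊑-antisym (·-mono (≃⇒⊑ e)) (·-mono (≃⇒⊑ (≃-sym e)))

  ⊕-cong : s ≃WT s' → t ≃WT t' → (s ⊕ t) ≃WT (s' ⊕ t')
  ⊕-cong e f = ⊑-antisym (⊕-lub (⊕-ubˡ ∘ ≃⇒⊑ e) (⊕-ubʳ ∘ ≃⇒⊑ f))
                         (⊕-lub (⊕-ubˡ ∘ ≃⇒⊑ (≃-sym e)) (⊕-ubʳ ∘ ≃⇒⊑ (≃-sym f)))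

  axiom-sound : {l r : OpenTerm A} → Axiom l r → ∀ σ → closeWith σ l ≃WT closeWith σ r
  axiom-sound A1 σ = ⊑-antisym (⊕-lub ⊕-ubʳ ⊕-ubˡ) (⊕-lub ⊕-ubʳ ⊕-ubˡ)
  axiom-sound A2 σ = ⊑-antisym (⊕-lub (⊕-lub ⊕-ubˡ (⊕-ubʳ ∘ ⊕-ubˡ)) (⊕-ubʳ ∘ ⊕-ubʳ))
                               (⊕-lub (⊕-ubˡ ∘ ⊕-ubˡ) (⊕-lub (⊕-ubˡ ∘ ⊕-ubʳ) ⊕-ubʳ))
  axiom-sound A3 σ = ⊑-antisym (⊕-lub (λ r → r) (λ r → r)) ⊕-ubˡ
  axiom-sound A4 σ = ⊑-antisym (⊕-lub (λ r → r) 𝟘-least) ⊕-ubˡ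
  axiom-sound WE σ = ⊑-antisym τ-intro τ-elim
  axiom-sound (TE a) σ = ⊑-antisym (⊕-lub (·-mono ⊕-ubˡ) (·-mono ⊕-ubʳ)) act-⊕-split

  instances-sound : {l r : OpenTerm A} → Axiom ⊢ l ≈ r → ∀ σ → closeWith σ l ≃WT closeWith σ r
  instances-sound (ax e)      σ = axiom-sound e σ
  instances-sound refl        σ w = ⇔.refl
  instances-sound (sym d)     σ = ≃-sym (instances-sound d σ)
  instances-sound (trans d e) σ w = ⇔.trans (instances-sound d σ w) (instances-sound e σ w)
  instances-sound (inst {l} {r} ρ d) σ =
    ≡.subst₂ _≃WT_ (≡.sym (subst-subst σ ρ l)) (≡.sym (subst-subst σ ρ r))
             (instances-sound d (closeWith σ ∘ ρ))
  instances-sound (pre α d)   σ = ·-cong (instances-sound d σ)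
  instances-sound (plus d e)  σ = ⊕-cong (instances-sound d σ) (instances-sound e σ)

  soundness : Sound {A} Axiom
  soundness _ _ = instances-sound

module _ {A : Set} where

  private variable
    r s s' s₁ s₂ t t' u v : OpenTerm A
    c : ClosedTerm A
    α : Act A
    a : A
    w : List A
    x : ℕ
    o : Obs

  infix 4 _≋_
  _≋_ : OpenTerm A → OpenTerm A → Set
  _≋_ = Axiom ⊢_≈_

  ≋-setoid : Setoid _ _
  ≋-setoid = record
    { Carrier       = OpenTerm A
    ; _≈_           = _≋_
    ; isEquivalence = record { refl = refl ; sym = sym ; trans = trans }
    }

  open SetoidReasoning ≋-setoid using (begin_; step-≈-⟩; step-≈-⟨; _∎)

  bind3 : OpenTerm A → OpenTerm A → OpenTerm A → ℕ → OpenTerm A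
  bind3 t u v 0 = t
  bind3 t u v 1 = u
  bind3 t u v 2 = v
  bind3 t u v _ = 𝟘

  ⊕-comm : ∀ t u → t ⊕ u ≋ u ⊕ t
  ⊕-comm t u = inst (bind3 t u 𝟘) (ax A1)

  ⊕-assoc : ∀ t u v → (t ⊕ u) ⊕ v ≋ t ⊕ (u ⊕ v)
  ⊕-assoc t u v = inst (bind3 t u v) (ax A2)

  ⊕-idem : ∀ t → t ⊕ t ≋ t
  ⊕-idem t = inst (bind3 t 𝟘 𝟘) (ax A3)

  ⊕-identityʳ : ∀ t → t ⊕ 𝟘 ≋ t
  ⊕-identityʳ t = inst (bind3 t 𝟘 𝟘) (ax A4)

  ⊕-identityˡ : ∀ t → 𝟘 ⊕ t ≋ t
  ⊕-identityˡ t = trans (⊕-comm 𝟘 t) (⊕-identityʳ t)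

  τ-law : ∀ t → t ≋ τ · t
  τ-law t = inst (bind3 t 𝟘 𝟘) (ax WE)

  act-⊕ : ∀ a t u → act a · t ⊕ act a · u ≋ act a · (t ⊕ u)
  act-⊕ a t u = inst (bind3 t u 𝟘) (ax (TE a))

  ⊕-swapʳ : ∀ t u v → (t ⊕ u) ⊕ v ≋ (t ⊕ v) ⊕ u
  ⊕-swapʳ t u v = begin
    (t ⊕ u) ⊕ v ≈⟨ ⊕-assoc t u v ⟩
    t ⊕ (u ⊕ v) ≈⟨ plus refl (⊕-comm u v) ⟩
    t ⊕ (v ⊕ u) ≈⟨ ⊕-assoc t v u ⟨
    (t ⊕ v) ⊕ u ∎

  infix 4 _—[_]→ₒ_ _⇒ₒ_
  data _—[_]→ₒ_ : OpenTerm A → Act A → OpenTerm A → Set where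
    opre  : α · t —[ α ]→ₒ t
    osumL : t —[ α ]→ₒ t' → t ⊕ u —[ α ]→ₒ t'
    osumR : t —[ α ]→ₒ t' → u ⊕ t —[ α ]→ₒ t'

  data _⇒ₒ_ : OpenTerm A → OpenTerm A → Set where
    ⇒ₒ-refl : t ⇒ₒ t
    ⇒ₒ-step : t —[ τ ]→ₒ t' → t' ⇒ₒ u → t ⇒ₒ u

  data Top (y : ℕ) : OpenTerm A → Set where
    top-var : Top y (var y)
    top-l   : Top y t → Top y (t ⊕ u)
    top-r   : Top y t → Top y (u ⊕ t)

  Ends : Obs → OpenTerm A → Set
  Ends trace      _ = ⊤
  Ends (var-at y) s = Top y s

  data Run (o : Obs) : OpenTerm A → List A → Set where
    stop : t ⇒ₒ s → Ends o s → Run o t []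
    move : t ⇒ₒ s₁ → s₁ —[ act a ]→ₒ s₂ → Run o s₂ w → Run o t (a ∷ w)

  run-trace : Run o t w → Run trace t w
  run-trace (stop p _)    = stop p tt
  run-trace (move p st r) = move p st (run-trace r)

  -- Run inclusion: the semantic counterpart of "t is a summand of u".
  infix 4 _≼_
  _≼_ : OpenTerm A → OpenTerm A → Set
  t ≼ u = ∀ o {w} → Run o t w → Run o u w

  ≼-refl : t ≼ t
  ≼-refl o r = r

  ≼-trans : t ≼ u → u ≼ v → t ≼ v
  ≼-trans f g o r = g o (f o r)

  Ends-lift : (∀ {y} → Top y t → Top y t') → Ends o t → Ends o t'
  Ends-lift {o = trace}    g _ = tt
  Ends-lift {o = var-at y} g e = g e

  ≼-lift : (∀ {α s} → t —[ α ]→ₒ s → t' —[ α ]→ₒ s) → (∀ {y} → Top y t → Top y t') → t ≼ t'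
  ≼-lift f g o (stop ⇒ₒ-refl e)              = stop ⇒ₒ-refl (Ends-lift g e)
  ≼-lift f g o (stop (⇒ₒ-step st p) e)       = stop (⇒ₒ-step (f st) p) e
  ≼-lift f g o (move ⇒ₒ-refl st r)           = move ⇒ₒ-refl (f st) r
  ≼-lift f g o (move (⇒ₒ-step st p) st' r)   = move (⇒ₒ-step (f st) p) st' r

  ≼-⊕ˡ : t ≼ t ⊕ u
  ≼-⊕ˡ = ≼-lift osumL top-l

  ≼-⊕ʳ : t ≼ u ⊕ t
  ≼-⊕ʳ = ≼-lift osumR top-r

  ≼-τ : u —[ τ ]→ₒ t → t ≼ u
  ≼-τ st o (stop p e)     = stop (⇒ₒ-step st p) e
  ≼-τ st o (move p st' r) = move (⇒ₒ-step st p) st' r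

  step-depth : t —[ α ]→ₒ t' → depth t' < depth t
  step-depth opre                  = ℕ.≤-refl
  step-depth {t ⊕ u} (osumL st) = ℕ.≤-trans (step-depth st) (ℕ.m≤m⊔n (depth t) (depth u))
  step-depth {u ⊕ t} (osumR st) = ℕ.≤-trans (step-depth st) (ℕ.m≤n⊔m (depth u) (depth t))

  taus-depth : t ⇒ₒ t' → depth t' ≤ depth t
  taus-depth ⇒ₒ-refl        = ℕ.≤-refl
  taus-depth (⇒ₒ-step st p) = ℕ.≤-trans (taus-depth p) (ℕ.<⇒≤ (step-depth st))

  run-length : Run o t w → length w ≤ depth t
  run-length (stop _ _)    = z≤n
  run-length (move p st r) = ℕ.≤-trans (s≤s (run-length r)) (ℕ.≤-trans (step-depth st) (taus-depth p))

  module _ (σ : ℕ → ClosedTerm A) where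

    private
      ⟦_⟧ : OpenTerm A → ClosedTerm A
      ⟦_⟧ = closeWith σ

    step-inst : t —[ α ]→ₒ t' → ⟦ t ⟧ —[ α ]→ ⟦ t' ⟧
    step-inst opre       = pre
    step-inst (osumL st) = sumL (step-inst st)
    step-inst (osumR st) = sumR (step-inst st)

    taus-inst : t ⇒ₒ t' → ⟦ t ⟧ ⇒ ⟦ t' ⟧
    taus-inst ⇒ₒ-refl        = ⇒-refl
    taus-inst (⇒ₒ-step st p) = ⇒-step (step-inst st) (taus-inst p)

    top-inst : Top x t → σ x —[ α ]→ c → ⟦ t ⟧ —[ α ]→ c
    top-inst top-var   st = st
    top-inst (top-l p) st = sumL (top-inst p st)
    top-inst (top-r p) st = sumR (top-inst p st)

    run-inst : Run o t w → WeakTrace ⟦ t ⟧ w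
    run-inst (stop _ _)    = wt-nil
    run-inst (move p st r) = wt-cons (taus-inst p) (step-inst st) (run-inst r)

    var-run-inst : ∀ {w'} → Run (var-at x) t w → WeakTrace (σ x) w' → WeakTrace ⟦ t ⟧ (w ++ w')
    var-run-inst (stop p top) wt-nil = wt-nil
    var-run-inst (stop p top) (wt-cons ⇒-refl st r) = wt-cons (taus-inst p) (top-inst top st) r
    var-run-inst (stop p top) (wt-cons (⇒-step st q) st' r) =
      wt-cons (⇒-trans (taus-inst p) (⇒-step (top-inst top st) q)) st' r
    var-run-inst (move p st r) v = wt-cons (taus-inst p) (step-inst st) (var-run-inst r v)

    step-of-inst : ∀ t → ⟦ t ⟧ —[ α ]→ c
      → (∃[ t' ] t —[ α ]→ₒ t' × c ≡ ⟦ t' ⟧) ⊎ (∃[ y ] Top y t × σ y —[ α ]→ c)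
    step-of-inst (var y) st  = inj₂ (y , top-var , st)
    step-of-inst (α · t) pre = inj₁ (t , opre , ≡.refl)
    step-of-inst (t ⊕ u) (sumL st) with step-of-inst t st
    ... | inj₁ (t' , st' , eq) = inj₁ (t' , osumL st' , eq)
    ... | inj₂ (y , top , st') = inj₂ (y , top-l top , st')
    step-of-inst (t ⊕ u) (sumR st) with step-of-inst u st
    ... | inj₁ (t' , st' , eq) = inj₁ (t' , osumR st' , eq)
    ... | inj₂ (y , top , st') = inj₂ (y , top-r top , st')

    taus-of-inst : ∀ t → ⟦ t ⟧ ⇒ c
      → (∃[ t' ] t ⇒ₒ t' × c ≡ ⟦ t' ⟧) ⊎ (∃[ y ] ∃[ t' ] t ⇒ₒ t' × Top y t' × σ y ⇒ c)
    taus-of-inst t ⇒-refl = inj₁ (t , ⇒ₒ-refl , ≡.refl)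
    taus-of-inst t (⇒-step st p) with step-of-inst t st
    ... | inj₂ (y , top , st') = inj₂ (y , t , ⇒ₒ-refl , top , ⇒-step st' p)
    ... | inj₁ (t₁ , st' , ≡.refl) with taus-of-inst t₁ p
    ...   | inj₁ (t₂ , q , eq)            = inj₁ (t₂ , ⇒ₒ-step st' q , eq)
    ...   | inj₂ (y , t₂ , q , top , q') = inj₂ (y , t₂ , ⇒ₒ-step st' q , top , q')

    ThroughVar : OpenTerm A → List A → Set
    ThroughVar t w = ∃[ y ] ∃[ w₁ ] ∃[ w₂ ] w ≡ w₁ ++ w₂ × Run (var-at y) t w₁ × WeakTrace (σ y) w₂

    trace-of-inst : ∀ t → WeakTrace ⟦ t ⟧ w → Run trace t w ⊎ ThroughVar t w
    trace-of-inst t wt-nil = inj₁ (stop ⇒ₒ-refl tt)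
    trace-of-inst t (wt-cons {a = a} {w = w} p st r) with taus-of-inst t p
    ... | inj₂ (y , t' , q , top , q') =
      inj₂ (y , [] , a ∷ w , ≡.refl , stop q top , wt-cons q' st r)
    ... | inj₁ (t' , q , ≡.refl) with step-of-inst t' st
    ...   | inj₂ (y , top , st') = inj₂ (y , [] , a ∷ w , ≡.refl , stop q top , wt-cons ⇒-refl st' r)
    ...   | inj₁ (t'' , st' , ≡.refl) with trace-of-inst t'' r
    ...     | inj₁ r' = inj₁ (move q st' r')
    ...     | inj₂ (y , w₁ , w₂ , eq , r' , r'') =
      inj₂ (y , a ∷ w₁ , w₂ , cong (a ∷_) eq , move q st' r' , r'')

  σ₀ : ℕ → ClosedTerm A
  σ₀ _ = 𝟘

  traces-from-𝟘-instance : closeWith σ₀ t ⊑ closeWith σ₀ u → Run trace t w → Run trace u w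
  traces-from-𝟘-instance {u = u} h r with trace-of-inst σ₀ u (h (run-inst σ₀ r))
  ... | inj₁ r' = r'
  ... | inj₂ (y , w₁ , w₂ , eq , r' , r'') with 𝟘-trace r''
  ...   | ≡.refl = ≡.subst (Run trace u) (≡.sym (≡.trans eq (++-identityʳ w₁))) (run-trace r')

  -- Embeddings of closed terms only reach embeddings of closed terms, so
  -- they have no variable runs.
  embed-step : ∀ p → embed p —[ α ]→ₒ t → ∃[ p' ] t ≡ embed p'
  embed-step 𝟘       ()
  embed-step (var ())
  embed-step (α · p) opre       = p , ≡.refl
  embed-step (p ⊕ q) (osumL st) = embed-step p st
  embed-step (p ⊕ q) (osumR st) = embed-step q st

  embed-taus : ∀ p → embed p ⇒ₒ t → ∃[ p' ] t ≡ embed p'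
  embed-taus p ⇒ₒ-refl = p , ≡.refl
  embed-taus p (⇒ₒ-step st q) with embed-step p st
  ... | p' , ≡.refl = embed-taus p' q

  embed-no-top : ∀ p → ¬ Top x (embed p)
  embed-no-top (var ())
  embed-no-top (p ⊕ q)  (top-l top) = embed-no-top p top
  embed-no-top (p ⊕ q)  (top-r top) = embed-no-top q top

  embed-no-var-run : ∀ p → ¬ Run (var-at x) (embed p) w
  embed-no-var-run p (stop q top) with embed-taus p q
  ... | p' , ≡.refl = embed-no-top p' top
  embed-no-var-run p (move q st r) with embed-taus p q
  ... | p' , ≡.refl with embed-step p' st
  ...   | p'' , ≡.refl = embed-no-var-run p'' r

  ≼-embed : ∀ p q → p ⊑ q → embed p ≼ embed q
  ≼-embed p q h trace = traces-from-𝟘-instance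
    (≡.subst₂ _⊑_ (≡.sym (close-embed σ₀ p)) (≡.sym (close-embed σ₀ q)) h)
  ≼-embed p q h (var-at x) r = ⊥-elim (embed-no-var-run p r)

  module _ (a b : A) (a≢b : ¬ a ≡ b) where

    word : List A → ClosedTerm A
    word []       = 𝟘
    word (c ∷ cs) = act c · word cs

    word-trace : ∀ ws → WeakTrace (word ws) ws
    word-trace []       = wt-nil
    word-trace (c ∷ cs) = wt-cons ⇒-refl pre (word-trace cs)

    b∉aᴺ-traces : ∀ N {v} → WeakTrace (word (replicate N a)) v → b ∉ v
    b∉aᴺ-traces (suc N) (wt-cons ⇒-refl pre r) (here b≡a)  = a≢b (≡.sym b≡a)
    b∉aᴺ-traces (suc N) (wt-cons ⇒-refl pre r) (there b∈v) = b∉aᴺ-traces N r b∈v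
    b∉aᴺ-traces zero    (wt-cons ⇒-refl () _) _
    b∉aᴺ-traces zero    (wt-cons (⇒-step () _) _ _) _
    b∉aᴺ-traces (suc N) (wt-cons (⇒-step () _) _ _) _

    probe : ℕ → ℕ → ℕ → ClosedTerm A
    probe x N y with y ℕ.≟ x
    ... | yes _ = act b · word (replicate N a)
    ... | no _  = 𝟘

    probe-hit : ∀ x N → WeakTrace (probe x N x) (b ∷ replicate N a)
    probe-hit x N with x ℕ.≟ x
    ... | yes _   = wt-cons ⇒-refl pre (word-trace (replicate N a))
    ... | no x≢x = ⊥-elim (x≢x ≡.refl)

    probe-trace : ∀ x N y {v} → WeakTrace (probe x N y) v
      → v ≡ [] ⊎ (y ≡ x × ∃[ ys ] v ≡ b ∷ ys × b ∉ ys)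
    probe-trace x N y r with y ℕ.≟ x
    probe-trace x N y r                           | no _    = inj₁ (𝟘-trace r)
    probe-trace x N y wt-nil                      | yes _   = inj₁ ≡.refl
    probe-trace x N y (wt-cons ⇒-refl pre r)      | yes y≡x = inj₂ (y≡x , _ , ≡.refl , b∉aᴺ-traces N r)
    probe-trace x N y (wt-cons (⇒-step () _) _ _) | yes _

    -- The marked word w b aᴺ is longer than any run of a term of depth N.
    marked-no-run : ∀ w → ¬ Run o u (w ++ b ∷ replicate (depth u) a)
    marked-no-run {u = u} w r = ℕ.<⇒≱ (marked-long w) (run-length r)
      where
      marked-long : ∀ w → depth u < length (w ++ b ∷ replicate (depth u) a)
      marked-long []      = s≤s (ℕ.≤-reflexive (≡.sym (length-replicate (depth u))))
      marked-long (c ∷ w) = ℕ.m<n⇒m<1+n (marked-long w)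

    marked-trace : ∀ N → Run (var-at x) t w → WeakTrace (closeWith (probe x N) t) (w ++ b ∷ replicate N a)
    marked-trace {x = x} N r = var-run-inst (probe x N) r (probe-hit x N)

    marked-run : WeakTrace (closeWith (probe x (depth u)) u) (w ++ b ∷ replicate (depth u) a)
      → Run (var-at x) u w
    marked-run {x = x} {u = u} {w = w} r with trace-of-inst (probe x (depth u)) u r
    ... | inj₁ r' = ⊥-elim (marked-no-run w r')
    ... | inj₂ (y , w₁ , w₂ , eq , r' , r'') with probe-trace x (depth u) y r''
    ...   | inj₁ ≡.refl =
      ⊥-elim (marked-no-run w (≡.subst (Run trace u) (≡.sym (≡.trans eq (++-identityʳ w₁))) (run-trace r')))
    ...   | inj₂ (≡.refl , ys , ≡.refl , b∉ys) =
      ≡.subst (Run (var-at x) u) (≡.sym (marker-split w w₁ (b∉aᴺ-traces _ (word-trace _)) b∉ys eq)) r'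

    ≼-from-instances : (∀ σ → closeWith σ t ⊑ closeWith σ u) → t ≼ u
    ≼-from-instances h trace      = traces-from-𝟘-instance (h σ₀)
    ≼-from-instances h (var-at x) r = marked-run (h _ (marked-trace _ r))

  Absorbs : OpenTerm A → OpenTerm A → Set
  Absorbs s r = s ⊕ r ≋ s

  absorbs-⊕ˡ : Absorbs s₁ r → Absorbs (s₁ ⊕ s₂) r
  absorbs-⊕ˡ {s₁ = s₁} {r = r} {s₂ = s₂} h = trans (⊕-swapʳ s₁ s₂ r) (plus h refl)

  absorbs-⊕ʳ : Absorbs s₂ r → Absorbs (s₁ ⊕ s₂) r
  absorbs-⊕ʳ {s₂ = s₂} {r = r} {s₁ = s₁} h = trans (⊕-assoc s₁ s₂ r) (plus refl h)

  absorbs-top : Top x s → Absorbs s (var x)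
  absorbs-top {x = x} top-var = ⊕-idem (var x)
  absorbs-top (top-l p) = absorbs-⊕ˡ (absorbs-top p)
  absorbs-top (top-r p) = absorbs-⊕ʳ (absorbs-top p)

  -- By WE, a term absorbs whatever its τ-successors absorb.
  absorbs-τ : s —[ τ ]→ₒ s' → Absorbs s' r → Absorbs s r
  absorbs-τ {s' = s'} {r = r} opre h = begin
    τ · s' ⊕ r ≈⟨ plus (τ-law s') refl ⟨
    s' ⊕ r     ≈⟨ h ⟩
    s'         ≈⟨ τ-law s' ⟩
    τ · s'     ∎
  absorbs-τ (osumL st) h = absorbs-⊕ˡ (absorbs-τ st h)
  absorbs-τ (osumR st) h = absorbs-⊕ʳ (absorbs-τ st h)

  absorbs-taus : s ⇒ₒ s' → Absorbs s' r → Absorbs s r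
  absorbs-taus ⇒ₒ-refl        h = h
  absorbs-taus (⇒ₒ-step st p) h = absorbs-τ st (absorbs-taus p h)

  -- By TE, a term with an a-transition absorbs a·𝟘.
  absorbs-act : s —[ act a ]→ₒ s' → Absorbs s (act a · 𝟘)
  absorbs-act {a = a} {s' = s'} opre = trans (act-⊕ a s' 𝟘) (pre (act a) (⊕-identityʳ s'))
  absorbs-act (osumL st) = absorbs-⊕ˡ (absorbs-act st)
  absorbs-act (osumR st) = absorbs-⊕ʳ (absorbs-act st)

  module _ (_≟_ : DecidableEquality A) where

    der : A → OpenTerm A → OpenTerm A
    der a 𝟘       = 𝟘
    der a (var x) = 𝟘
    der a (τ · t) = der a t
    der a (act b · t) with b ≟ a
    ... | yes _ = t
    ... | no _  = 𝟘
    der a (t ⊕ u) = der a t ⊕ der a u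

    der-step : s —[ act a ]→ₒ s' → s' ≼ der a s
    der-step {a = a} opre with a ≟ a
    ... | yes _   = ≼-refl
    ... | no a≢a = ⊥-elim (a≢a ≡.refl)
    der-step (osumL st) = ≼-trans (der-step st) ≼-⊕ˡ
    der-step (osumR st) = ≼-trans (der-step st) ≼-⊕ʳ

    der-τ : s —[ τ ]→ₒ s' → der a s' ≼ der a s
    der-τ opre       = ≼-refl
    der-τ (osumL st) = ≼-trans (der-τ st) ≼-⊕ˡ
    der-τ (osumR st) = ≼-trans (der-τ st) ≼-⊕ʳ

    der-taus : s ⇒ₒ s' → der a s' ≼ der a s
    der-taus ⇒ₒ-refl        = ≼-refl
    der-taus (⇒ₒ-step st p) = ≼-trans (der-taus p) (der-τ st)

    ≼-der : act a · t ≼ u → t ≼ der a u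
    ≼-der h o r with h o (move ⇒ₒ-refl opre r)
    ... | move p st r' = der-taus p o (der-step st o r')

    -- Beside u, a summand a·q may be enlarged by the a-derivative of u (by TE).
    der-expand : ∀ a u q → u ⊕ act a · q ≋ u ⊕ act a · (der a u ⊕ q)
    der-expand a 𝟘       q = plus refl (pre (act a) (sym (⊕-identityˡ q)))
    der-expand a (var x) q = plus refl (pre (act a) (sym (⊕-identityˡ q)))
    der-expand a (τ · t) q = begin
      τ · t ⊕ act a · q               ≈⟨ plus (τ-law t) refl ⟨
      t ⊕ act a · q                   ≈⟨ der-expand a t q ⟩
      t ⊕ act a · (der a t ⊕ q)       ≈⟨ plus (τ-law t) refl ⟩
      τ · t ⊕ act a · (der a t ⊕ q)   ∎
    der-expand a (act b · t) q with b ≟ a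
    ... | no _       = plus refl (pre (act a) (sym (⊕-identityˡ q)))
    ... | yes ≡.refl = begin
      act b · t ⊕ act b · q            ≈⟨ act-⊕ b t q ⟩
      act b · (t ⊕ q)                  ≈⟨ pre (act b) (plus (⊕-idem t) refl) ⟨
      act b · ((t ⊕ t) ⊕ q)            ≈⟨ pre (act b) (⊕-assoc t t q) ⟩
      act b · (t ⊕ (t ⊕ q))            ≈⟨ act-⊕ b t (t ⊕ q) ⟨
      act b · t ⊕ act b · (t ⊕ q)      ∎
    der-expand a (t₁ ⊕ t₂) q = begin
      (t₁ ⊕ t₂) ⊕ act a · q                ≈⟨ ⊕-assoc t₁ t₂ _ ⟩
      t₁ ⊕ (t₂ ⊕ act a · q)                ≈⟨ plus refl (der-expand a t₂ q) ⟩
      t₁ ⊕ (t₂ ⊕ act a · (d₂ ⊕ q))         ≈⟨ ⊕-assoc t₁ t₂ _ ⟨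
      (t₁ ⊕ t₂) ⊕ act a · (d₂ ⊕ q)         ≈⟨ ⊕-swapʳ t₁ t₂ _ ⟩
      (t₁ ⊕ act a · (d₂ ⊕ q)) ⊕ t₂         ≈⟨ plus (der-expand a t₁ (d₂ ⊕ q)) refl ⟩
      (t₁ ⊕ act a · (d₁ ⊕ (d₂ ⊕ q))) ⊕ t₂  ≈⟨ ⊕-swapʳ t₁ _ t₂ ⟩
      (t₁ ⊕ t₂) ⊕ act a · (d₁ ⊕ (d₂ ⊕ q))  ≈⟨ plus refl (pre (act a) (⊕-assoc d₁ d₂ q)) ⟨
      (t₁ ⊕ t₂) ⊕ act a · ((d₁ ⊕ d₂) ⊕ q)  ∎
      where
      d₁ = der a t₁
      d₂ = der a t₂

    saturate : ∀ t u → t ≼ u → Absorbs u t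
    saturate 𝟘 u h = ⊕-identityʳ u
    saturate (var x) u h with h (var-at x) (stop ⇒ₒ-refl top-var)
    ... | stop p top = absorbs-taus p (absorbs-top top)
    saturate (τ · t) u h = trans (plus refl (sym (τ-law t))) (saturate t u (≼-trans (≼-τ opre) h))
    saturate (act a · t) u h = begin
      u ⊕ act a · t        ≈⟨ der-expand a u t ⟩
      u ⊕ act a · (d ⊕ t)  ≈⟨ plus refl (pre (act a) (saturate t d (≼-der h))) ⟩
      u ⊕ act a · d        ≈⟨ plus refl (pre (act a) (⊕-identityʳ d)) ⟨
      u ⊕ act a · (d ⊕ 𝟘)  ≈⟨ der-expand a u 𝟘 ⟨
      u ⊕ act a · 𝟘        ≈⟨ u-has-a ⟩
      u                    ∎
      where
      d = der a u
      u-has-a : Absorbs u (act a · 𝟘)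
      u-has-a with h trace (move ⇒ₒ-refl opre (stop ⇒ₒ-refl tt))
      ... | move p st _ = absorbs-taus p (absorbs-act st)
    saturate (t₁ ⊕ t₂) u h = begin
      u ⊕ (t₁ ⊕ t₂)  ≈⟨ ⊕-assoc u t₁ t₂ ⟨
      (u ⊕ t₁) ⊕ t₂  ≈⟨ plus (saturate t₁ u (≼-trans ≼-⊕ˡ h)) refl ⟩
      u ⊕ t₂         ≈⟨ saturate t₂ u (≼-trans ≼-⊕ʳ h) ⟩
      u              ∎

    ≼-antisym : t ≼ u → u ≼ t → t ≋ u
    ≼-antisym {t = t} {u = u} h h' = begin
      t      ≈⟨ saturate u t h' ⟨
      t ⊕ u  ≈⟨ ⊕-comm t u ⟩
      u ⊕ t  ≈⟨ saturate t u h ⟩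
      u      ∎

    ground-completeness : GroundComplete {A} Axiom
    ground-completeness p q e = ≼-antisym (≼-embed p q (≃⇒⊑ e)) (≼-embed q p (≃⇒⊑ (≃-sym e)))

    omega-completeness : AtLeastTwo A → OmegaComplete {A} Axiom
    omega-completeness (a , b , a≢b) t u h =
      ≼-antisym (≼-from-instances a b a≢b (λ σ → ≃⇒⊑ (equiv σ)))
                (≼-from-instances a b a≢b (λ σ → ≃⇒⊑ (≃-sym (equiv σ))))
      where
      -- Closed instances are provably, hence by soundness semantically, equal.
      equiv : ∀ σ → closeWith σ t ≃WT closeWith σ u
      equiv σ = ≡.subst₂ _≃WT_ (close-embed σ₀ _) (close-embed σ₀ _) (instances-sound (h σ) σ₀)

theorem4p5 : (A : Set) → Countable A → A
    → Sound {A} Axiom × GroundComplete {A} Axiom × (AtLeastTwo A → OmegaComplete {A} Axiom)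
theorem4p5 A countable _ = soundness , ground-completeness _≟_ , omega-completeness _≟_
  where
  _≟_ : DecidableEquality A
  _≟_ = countable-decEq countable
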